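{- For every affine signed permutation $\pi$ and every loop $\ell_i\in L$, \[\#\mathrm{big}(\pi\ell_i)=\#\mathrm{big}(\pi)\pm1\quad\text{and}\quad \#\mathrm{neg}(\pi\ell_i)=\#\mathrm{neg}(\pi)\pm1.\]
   Context: Fix $n\ge 3$. An affine signed permutation is a bijection $\pi:\mathbb Z\to\mathbb Z$ with $\pi(i+2n)=\pi(i)+2n$ and $\pi(-i)=-\pi(i)$ for all $i$. $\#\mathrm{neg}(\pi)$ is the number of elements of $\{i\in\mathbb Z: i>0,\ \pi(i)<0\}$ and $\#\mathrm{big}(\pi)$ is the number of elements of $\{i\in\mathbb Z: i<n,\ \pi(i)>n\}$. For $i\in\{\pm1,\dots,\pm(n-1)\}$, the loop $\ell_i$ is the permutation mapping $j\mapsto j+2n$ if $j\equiv i\pmod{2n}$, $j\mapsto j-2n$ if $j\equiv -i\pmod{2n}$, and fixing all other $j$; $L$ is the set of these loops. Products compose right to left. -}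

module Defs where

open import Data.Nat as ℕ using (ℕ; zero; suc)
open import Data.Integer as ℤ using (ℤ; +_; -_; _+_; _-_; _<_; _%ℕ_)
open import Data.Bool using (Bool; if_then_else_)
open import Data.List using (List; length)
open import Data.List.Membership.Propositional using (_∈_)
open import Data.List.Relation.Unary.Unique.Propositional using (Unique)
open import Data.Product using (Σ; _×_)
open import Function.Bundles using (_⇔_)
open import Function.Definitions using (Bijective)
open import Relation.Binary.PropositionalEquality using (_≡_)
open import Relation.Nullary.Decidable using (⌊_⌋)

period : ℕ → ℕ
period n = 2 ℕ.* n

congMod : ℕ → ℤ → ℤ → Bool
congMod zero    j i = ⌊ j ℤ.≟ i ⌋
congMod (suc k) j i = ⌊ ((j - i) %ℕ suc k) ℕ.≟ 0 ⌋

record AffSignedPerm (n : ℕ) : Set where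
  field
    fn       : ℤ → ℤ
    bijective : Bijective _≡_ _≡_ fn
    periodic : ∀ i → fn (i + + period n) ≡ fn i + + period n
    signed   : ∀ i → fn (- i) ≡ - fn i
open AffSignedPerm public

loop : (n : ℕ) → ℤ → ℤ → ℤ
loop n i j =
  if congMod (period n) j i then j + + period n
  else (if congMod (period n) j (- i) then j - + period n else j)

mulLoop : {n : ℕ} → AffSignedPerm n → ℤ → ℤ → ℤ
mulLoop {n} π i j = fn π (loop n i j)

HasCard : (ℤ → Set) → ℕ → Set
HasCard P k = Σ (List ℤ) λ xs → Unique xs × length xs ≡ k × (∀ x → (x ∈ xs) ⇔ P x)

NegSet : (ℤ → ℤ) → ℤ → Set
NegSet f i = + 0 < i × f i < + 0

BigSet : ℕ → (ℤ → ℤ) → ℤ → Set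
BigSet n f i = i < + n × + n < f i

NumNeg : (ℤ → ℤ) → ℕ → Set
NumNeg f k = HasCard (NegSet f) k

NumBig : ℕ → (ℤ → ℤ) → ℕ → Set
NumBig n f k = HasCard (BigSet n f) k

-- Substituting y = ℓ_i x (ℓ_{-i} is the inverse of ℓ_i) turns the sets counted by
-- #big(πℓ_i) and #neg(πℓ_i) into {y : ℓ_{-i} y < n, π y > n} and {y : 0 < ℓ_{-i} y, π y < 0}:
-- only the condition on the position y changes. Now ℓ_{-i} shifts the class of -i up and
-- the class of i down by 2n, and such a shift carries exactly one point of the class across
-- a given threshold. So the position condition gains exactly one point g and loses exactly
-- one point l: g = i + 2n and l = -i for #big, g = -b and l = b for #neg, where b ∈ (0, 2n)
-- represents the class of i. As π (i + 2n) = π i + 2n and π (-i) = -π i with π i ≠ -n = π (-n),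
-- and π (-b) = -π b with π b ≠ 0 = π 0, exactly one of g, l satisfies the condition on π y,
-- so the count changes by one. Both counts are finite because π x - x is 2n-periodic.

module Submission where

open import Defs
open import Data.Bool using (true; false)
open import Data.Integer as ℤ
  using (ℤ; +_; +[1+_]; -[1+_]; -_; _+_; _-_; _*_; _≤_; _<_; ∣_∣; 0ℤ; _%ℕ_; _/ℕ_)
import Data.Integer.Properties as ℤ
open import Data.Integer.DivMod using (a≡a%ℕn+[a/ℕn]*n; n%ℕd<d)
open import Data.Integer.Divisibility.Signed
  using (_∣_; divides; ∣-refl; ∣m∣n⇒∣m+n; ∣m⇒∣-m; ∣⇒∣ᵤ)
open import Data.Integer.Tactic.RingSolver using (solve-∀)
open import Data.List using (List; _∷_; length; filter; map; upTo; deduplicate)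
open import Data.List.Membership.Propositional using (_∈_)
open import Data.List.Membership.Propositional.Properties
  using (∈-filter⁺; ∈-filter⁻; ∈-map⁺; ∈-map⁻; ∈-upTo⁺; ∈-deduplicate⁺)
open import Data.List.Properties using (filter-all; filter-accept; filter-reject; length-map)
open import Data.List.Relation.Unary.All as All using ()
open import Data.List.Relation.Unary.AllPairs using (_∷_)
open import Data.List.Relation.Unary.Any using (here; there)
open import Data.List.Relation.Unary.Unique.DecPropositional.Properties ℤ._≟_ using (deduplicate-!)
open import Data.List.Relation.Unary.Unique.Propositional using (Unique)
import Data.List.Relation.Unary.Unique.Propositional.Properties as Unique
open import Data.Nat as ℕ using (ℕ; zero; suc; s≤s)
import Data.Nat.Divisibility as ℕ
import Data.Nat.Properties as ℕ
open import Data.List.Extrema ℕ.≤-totalOrder using (max; xs≤max)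
open import Data.Product using (Σ; ∃; ∃-syntax; _×_; _,_; proj₁; proj₂)
open import Data.Product.Function.NonDependent.Propositional using (_×-⇔_)
open import Data.Sum as Sum using (_⊎_; inj₁; inj₂)
open import Function using (_∘_; const)
open import Function.Bundles using (_⇔_; mk⇔; Equivalence)
open import Function.Construct.Identity using (⇔-id)
open import Function.Construct.Symmetry using (⇔-sym)
open import Relation.Binary.Definitions using (tri<; tri≈; tri>)
open import Relation.Binary.PropositionalEquality
open import Relation.Nullary using (¬_; ¬?; yes; no; contradiction)
open import Relation.Nullary.Decidable using (_×-dec_)
open import Relation.Nullary.Reflects using (Reflects; ofʸ; ofⁿ)
open import Relation.Unary using (Decidable)

open Equivalence

private variable
  P Q : ℤ → Set
  k : ℕ

OffByOne : ℕ → ℕ → Set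
OffByOne k l = l ≡ suc k ⊎ k ≡ suc l

HasCard-cong : (∀ x → P x ⇔ Q x) → HasCard P k → HasCard Q k
HasCard-cong P⇔Q (xs , uniq , len , mem) =
  xs , uniq , len , λ x → mk⇔ (to (P⇔Q x) ∘ to (mem x)) (from (mem x) ∘ from (P⇔Q x))

HasCard-insert : ∀ {a} → ¬ P a → (∀ x → Q x ⇔ (P x ⊎ x ≡ a)) → HasCard P k → HasCard Q (suc k)
HasCard-insert {P} {Q} {a = a} ¬Pa Q⇔ (xs , uniq , len , mem) =
  a ∷ xs , All.tabulate a≢ ∷ uniq , cong suc len , λ x → mk⇔ (∈⇒Q x) (Q⇒∈ x)
  where
  a≢ : ∀ {y} → y ∈ xs → a ≢ y
  a≢ y∈xs refl = ¬Pa (to (mem _) y∈xs)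
  ∈⇒Q : ∀ x → x ∈ a ∷ xs → Q x
  ∈⇒Q x (here refl)  = from (Q⇔ x) (inj₂ refl)
  ∈⇒Q x (there x∈xs) = from (Q⇔ x) (inj₁ (to (mem x) x∈xs))
  Q⇒∈ : ∀ x → Q x → x ∈ a ∷ xs
  Q⇒∈ x Qx with to (Q⇔ x) Qx
  ... | inj₁ Px   = there (from (mem x) Px)
  ... | inj₂ refl = here refl

length-filter-≢ : ∀ {b} {xs : List ℤ} → Unique xs → b ∈ xs →
                  length xs ≡ suc (length (filter (¬? ∘ (ℤ._≟ b)) xs))
length-filter-≢ {b} {_ ∷ xs} (b≢xs ∷ _) (here refl)
  rewrite filter-reject (¬? ∘ (ℤ._≟ b)) {b} {xs} (λ b≢b → b≢b refl)
        | filter-all (¬? ∘ (ℤ._≟ b)) {xs} (All.map (λ b≢y y≡b → b≢y (sym y≡b)) b≢xs)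
        = refl
length-filter-≢ {b} {y ∷ xs} (y≢xs ∷ uniq) (there b∈xs)
  rewrite filter-accept (¬? ∘ (ℤ._≟ b)) {y} {xs} (All.lookup y≢xs b∈xs)
        = cong suc (length-filter-≢ uniq b∈xs)

HasCard-delete : ∀ {b} → P b → (∀ x → Q x ⇔ (P x × x ≢ b)) → HasCard P k →
                 ∃[ l ] k ≡ suc l × HasCard Q l
HasCard-delete {P} {Q} {b = b} Pb Q⇔ (xs , uniq , refl , mem) =
  _ , length-filter-≢ uniq (from (mem b) Pb) ,
  ys , Unique.filter⁺ ≢b? uniq , refl , λ x → mk⇔ (∈⇒Q x) (Q⇒∈ x)
  where
  ≢b? = ¬? ∘ (ℤ._≟ b)
  ys = filter ≢b? xs
  ∈⇒Q : ∀ x → x ∈ ys → Q x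
  ∈⇒Q x x∈ys = let x∈xs , x≢b = ∈-filter⁻ ≢b? x∈ys in from (Q⇔ x) (to (mem x) x∈xs , x≢b)
  Q⇒∈ : ∀ x → Q x → x ∈ ys
  Q⇒∈ x Qx = let Px , x≢b = to (Q⇔ x) Qx in ∈-filter⁺ ≢b? (from (mem x) Px) x≢b

HasCard-exchange : ∀ a b → ¬ P a → ¬ Q b → (∀ x → x ≢ a → x ≢ b → Q x ⇔ P x) →
                   (Q a × ¬ P b) ⊎ (¬ Q a × P b) → HasCard P k → ∃[ l ] HasCard Q l × OffByOne k l
HasCard-exchange {P} {Q} a b ¬Pa ¬Qb Q⇔P (inj₁ (Qa , ¬Pb)) card =
  _ , HasCard-insert ¬Pa Q≡P+a card , inj₁ refl
  where
  Q≡P+a : ∀ x → Q x ⇔ (P x ⊎ x ≡ a)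
  Q≡P+a x = mk⇔ Q⇒ ⇒Q
    where
    Q⇒ : Q x → P x ⊎ x ≡ a
    Q⇒ Qx with x ℤ.≟ a | x ℤ.≟ b
    ... | yes x≡a | _        = inj₂ x≡a
    ... | no _    | yes refl = contradiction Qx ¬Qb
    ... | no x≢a  | no x≢b   = inj₁ (to (Q⇔P x x≢a x≢b) Qx)
    ⇒Q : P x ⊎ x ≡ a → Q x
    ⇒Q (inj₁ Px)   = from (Q⇔P x (λ { refl → ¬Pa Px }) (λ { refl → ¬Pb Px })) Px
    ⇒Q (inj₂ refl) = Qa
HasCard-exchange {P} {Q} a b ¬Pa ¬Qb Q⇔P (inj₂ (¬Qa , Pb)) card =
  let l , k≡1+l , card′ = HasCard-delete Pb Q≡P-b card in l , card′ , inj₂ k≡1+l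
  where
  Q≡P-b : ∀ x → Q x ⇔ (P x × x ≢ b)
  Q≡P-b x = mk⇔ Q⇒ ⇒Q
    where
    Q⇒ : Q x → P x × x ≢ b
    Q⇒ Qx = to (Q⇔P x x≢a x≢b) Qx , x≢b
      where
      x≢a : x ≢ a
      x≢a refl = ¬Qa Qx
      x≢b : x ≢ b
      x≢b refl = ¬Qb Qx
    ⇒Q : P x × x ≢ b → Q x
    ⇒Q (Px , x≢b) = from (Q⇔P x (λ { refl → ¬Pa Px }) x≢b) Px

HasCard-∘ : ∀ {h h⁻¹ : ℤ → ℤ} → (∀ x → h⁻¹ (h x) ≡ x) → (∀ y → h (h⁻¹ y) ≡ y) →
            HasCard Q k → HasCard (Q ∘ h) k
HasCard-∘ {Q} {h = h} {h⁻¹} h⁻¹∘h h∘h⁻¹ (ys , uniq , len , mem) =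
  map h⁻¹ ys , Unique.map⁺ h⁻¹-injective uniq , trans (length-map h⁻¹ ys) len ,
  λ x → mk⇔ (∈⇒Q∘h x) (Q∘h⇒∈ x)
  where
  h⁻¹-injective : ∀ {y z} → h⁻¹ y ≡ h⁻¹ z → y ≡ z
  h⁻¹-injective {y} {z} eq = trans (sym (h∘h⁻¹ y)) (trans (cong h eq) (h∘h⁻¹ z))
  ∈⇒Q∘h : ∀ x → x ∈ map h⁻¹ ys → Q (h x)
  ∈⇒Q∘h x x∈ with ∈-map⁻ h⁻¹ x∈
  ... | y , y∈ys , refl = subst Q (sym (h∘h⁻¹ y)) (to (mem y) y∈ys)
  Q∘h⇒∈ : ∀ x → Q (h x) → x ∈ map h⁻¹ ys
  Q∘h⇒∈ x Qhx = subst (_∈ map h⁻¹ ys) (h⁻¹∘h x) (∈-map⁺ h⁻¹ (from (mem (h x)) Qhx))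

interval : ℤ → ℤ → List ℤ
interval lo hi = map (λ k → lo + + k) (upTo ∣ hi - lo ∣)

∈-interval⁺ : ∀ {lo hi x} → lo ≤ x → x < hi → x ∈ interval lo hi
∈-interval⁺ {lo} {hi} {x} lo≤x x<hi =
  subst (_∈ interval lo hi) lo+∣x-lo∣≡x
    (∈-map⁺ (λ k → lo + + k) (∈-upTo⁺ (ℤ.drop‿+<+ ∣x-lo∣<∣hi-lo∣)))
  where
  ∣x-lo∣≡x-lo : + ∣ x - lo ∣ ≡ x - lo
  ∣x-lo∣≡x-lo = ℤ.0≤i⇒+∣i∣≡i (ℤ.i≤j⇒0≤j-i lo≤x)
  ∣hi-lo∣≡hi-lo : + ∣ hi - lo ∣ ≡ hi - lo
  ∣hi-lo∣≡hi-lo = ℤ.0≤i⇒+∣i∣≡i (ℤ.i≤j⇒0≤j-i (ℤ.<⇒≤ (ℤ.≤-<-trans lo≤x x<hi)))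
  lo+∣x-lo∣≡x : lo + + ∣ x - lo ∣ ≡ x
  lo+∣x-lo∣≡x = trans (cong (λ d → lo + d) ∣x-lo∣≡x-lo) (a+[b-a]≡b lo x)
    where
    a+[b-a]≡b : ∀ a b → a + (b - a) ≡ b
    a+[b-a]≡b = solve-∀
  ∣x-lo∣<∣hi-lo∣ : + ∣ x - lo ∣ < + ∣ hi - lo ∣
  ∣x-lo∣<∣hi-lo∣ = subst₂ _<_ (sym ∣x-lo∣≡x-lo) (sym ∣hi-lo∣≡hi-lo) (ℤ.+-monoˡ-< (- lo) x<hi)

bounded⇒HasCard : ∀ {lo hi} → Decidable P → (∀ x → P x → lo ≤ x × x < hi) → ∃ (HasCard P)
bounded⇒HasCard {P} {lo} {hi} P? bounds =
  _ , filter P? xs , Unique.filter⁺ P? (deduplicate-! (interval lo hi)) , refl ,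
  λ x → mk⇔ (proj₂ ∘ ∈-filter⁻ P? {xs = xs}) (λ Px → ∈-filter⁺ P? (P⇒∈ x Px) Px)
  where
  xs = deduplicate ℤ._≟_ (interval lo hi)
  P⇒∈ : ∀ x → P x → x ∈ xs
  P⇒∈ x Px = let lo≤x , x<hi = bounds x Px in ∈-deduplicate⁺ ℤ._≟_ (∈-interval⁺ lo≤x x<hi)

HasCard-relabel : ∀ {Pos Val : ℤ → Set} {h h⁻¹ : ℤ → ℤ} →
                  (∀ x → h⁻¹ (h x) ≡ x) → (∀ y → h (h⁻¹ y) ≡ y) →
                  ∀ g l → ¬ Pos g → Pos (h⁻¹ g) → Pos l → ¬ Pos (h⁻¹ l) →
                  (∀ y → y ≢ g → y ≢ l → Pos (h⁻¹ y) ⇔ Pos y) →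
                  (Val g × ¬ Val l) ⊎ (¬ Val g × Val l) →
                  HasCard (λ y → Pos y × Val y) k →
                  ∃[ k′ ] HasCard (λ x → Pos x × Val (h x)) k′ × OffByOne k k′
HasCard-relabel {Pos = Pos} {Val} {h} {h⁻¹} h⁻¹∘h h∘h⁻¹ g l
                ¬Pos-g Pos-h⁻¹g Pos-l ¬Pos-h⁻¹l Pos-off Val-xor card =
  let k′ , card′ , k~k′ = HasCard-exchange g l (¬Pos-g ∘ proj₁) (¬Pos-h⁻¹l ∘ proj₁) off xor card
  in  k′ , HasCard-cong cancel (HasCard-∘ h⁻¹∘h h∘h⁻¹ card′) , k~k′
  where
  off : ∀ y → y ≢ g → y ≢ l → (Pos (h⁻¹ y) × Val y) ⇔ (Pos y × Val y)
  off y y≢g y≢l = Pos-off y y≢g y≢l ×-⇔ ⇔-id _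
  xor : ((Pos (h⁻¹ g) × Val g) × ¬ (Pos l × Val l)) ⊎ (¬ (Pos (h⁻¹ g) × Val g) × (Pos l × Val l))
  xor = Sum.map (λ (Vg , ¬Vl) → (Pos-h⁻¹g , Vg) , ¬Vl ∘ proj₂)
                (λ (¬Vg , Vl) → ¬Vg ∘ proj₂ , (Pos-l , Vl)) Val-xor
  cancel : ∀ x → (Pos (h⁻¹ (h x)) × Val (h x)) ⇔ (Pos x × Val (h x))
  cancel x = subst (λ z → (Pos z × Val (h x)) ⇔ (Pos x × Val (h x))) (sym (h⁻¹∘h x)) (⇔-id _)

x+k-k≡x : ∀ x k → x + k - k ≡ x
x+k-k≡x = solve-∀

x-k+k≡x : ∀ x k → x - k + k ≡ x
x-k+k≡x = solve-∀

+-cancelʳ-≡ : ∀ {x y} k → x + k ≡ y + k → x ≡ y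
+-cancelʳ-≡ {x} {y} k eq = trans (sym (x+k-k≡x x k)) (trans (cong (_- k) eq) (x+k-k≡x y k))

+-cancelʳ-≤ : ∀ {x y} k → x + k ≤ y + k → x ≤ y
+-cancelʳ-≤ {x} {y} k le = subst₂ _≤_ (x+k-k≡x x k) (x+k-k≡x y k) (ℤ.+-monoˡ-≤ (- k) le)

+-cancelʳ-< : ∀ {x y} k → x + k < y + k → x < y
+-cancelʳ-< {x} {y} k lt = subst₂ _<_ (x+k-k≡x x k) (x+k-k≡x y k) (ℤ.+-monoˡ-< (- k) lt)

≤+⇒-≤ : ∀ {x y} k → x ≤ y + k → x - k ≤ y
≤+⇒-≤ {x} {y} k le = subst (x - k ≤_) (x+k-k≡x y k) (ℤ.+-monoˡ-≤ (- k) le)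

-<⇒<+ : ∀ {x y} k → x - k < y → x < y + k
-<⇒<+ {x} {y} k lt = subst (_< y + k) (x-k+k≡x x k) (ℤ.+-monoˡ-< k lt)

+≤⇒≤- : ∀ {x y} k → x + k ≤ y → x ≤ y - k
+≤⇒≤- {x} {y} k le = +-cancelʳ-≤ k (subst (x + k ≤_) (sym (x-k+k≡x y k)) le)

+<⇒<- : ∀ {x y} k → x + k < y → x < y - k
+<⇒<- {x} {y} k lt = +-cancelʳ-< k (subst (x + k <_) (sym (x-k+k≡x y k)) lt)

x≡y+[x-y] : ∀ x y → x ≡ y + (x - y)
x≡y+[x-y] = solve-∀

-[x-y]≡y-x : ∀ x y → - (x - y) ≡ y - x
-[x-y]≡y-x = solve-∀

m≤[1+k]*m : ∀ {m} k → + m ≤ + suc k * + m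
m≤[1+k]*m {m} k = subst (+ m ≤_) (ℤ.pos-* (suc k) m) (ℤ.+≤+ (ℕ.m≤m+n m (k ℕ.* m)))

i≡-i⇒i≡0 : ∀ {i} → i ≡ - i → i ≡ 0ℤ
i≡-i⇒i≡0 {+ zero}    _  = refl
i≡-i⇒i≡0 {+[1+ _ ]}  ()
i≡-i⇒i≡0 { -[1+ _ ]} ()

x≡-x+[y+y]⇒x≡y : ∀ {x y} → x ≡ - x + (y + y) → x ≡ y
x≡-x+[y+y]⇒x≡y {x} {y} x≡ = ℤ.i-j≡0⇒i≡j x y (i≡-i⇒i≡0 (begin
  x - y                    ≡⟨ cong (_- y) x≡ ⟩
  - x + (y + y) - y        ≡⟨ -x+[y+y]-y≡-[x-y] x y ⟩
  - (x - y)                ∎))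
  where
  open ≡-Reasoning
  -x+[y+y]-y≡-[x-y] : ∀ x y → - x + (y + y) - y ≡ - (x - y)
  -x+[y+y]-y≡-[x-y] = solve-∀

i≤+∣i∣ : ∀ i → i ≤ + ∣ i ∣
i≤+∣i∣ (+ _)     = ℤ.≤-refl
i≤+∣i∣ -[1+ _ ]  = ℤ.-≤+

-+∣i∣≤i : ∀ i → - + ∣ i ∣ ≤ i
-+∣i∣≤i (+ _)    = ℤ.neg-≤-pos
-+∣i∣≤i -[1+ _ ] = ℤ.≤-refl

-v<0⊻v<0 : ∀ {v} → v ≢ 0ℤ → (- v < 0ℤ × ¬ v < 0ℤ) ⊎ (¬ - v < 0ℤ × v < 0ℤ)
-v<0⊻v<0 {+ zero}    v≢0 = contradiction refl v≢0
-v<0⊻v<0 {+[1+ _ ]}  _   = inj₁ (ℤ.-<+ , λ { (ℤ.+<+ ()) })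
-v<0⊻v<0 { -[1+ _ ]} _   = inj₂ ((λ { (ℤ.+<+ ()) }) , ℤ.-<+)

-- A record rather than a synonym for + m ∣ x - y, so that x and y can be inferred.
infix 4 _≡_mod_
record _≡_mod_ (x y : ℤ) (m : ℕ) : Set where
  constructor ≡mod
  field m∣x-y : + m ∣ x - y

≡mod-refl : ∀ {m x} → x ≡ x mod m
≡mod-refl {m} {x} = ≡mod (divides 0ℤ (trans (ℤ.+-inverseʳ x) (sym (ℤ.*-zeroˡ (+ m)))))

≡mod-sym : ∀ {m x y} → x ≡ y mod m → y ≡ x mod m
≡mod-sym {x = x} {y} (≡mod m∣x-y) = ≡mod (subst (_ ∣_) (-[x-y]≡y-x x y) (∣m⇒∣-m m∣x-y))

≡mod-trans : ∀ {m x y z} → x ≡ y mod m → y ≡ z mod m → x ≡ z mod m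
≡mod-trans {x = x} {y} {z} (≡mod m∣x-y) (≡mod m∣y-z) =
  ≡mod (subst (_ ∣_) (ℤ.+-minus-telescope x y z) (∣m∣n⇒∣m+n m∣x-y m∣y-z))

≡mod-neg : ∀ {m x y} → x ≡ y mod m → - x ≡ - y mod m
≡mod-neg {x = x} {y} (≡mod m∣x-y) = ≡mod (subst (_ ∣_) (-[x-y]≡-x--y x y) (∣m⇒∣-m m∣x-y))
  where
  -[x-y]≡-x--y : ∀ x y → - (x - y) ≡ - x - - y
  -[x-y]≡-x--y = solve-∀

≡mod-+ʳ : ∀ {m x y} z → x ≡ y mod m → x + z ≡ y + z mod m
≡mod-+ʳ {x = x} {y} z (≡mod m∣x-y) = ≡mod (subst (_ ∣_) (x-y≡[x+z]-[y+z] x y z) m∣x-y)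
  where
  x-y≡[x+z]-[y+z] : ∀ x y z → x - y ≡ (x + z) - (y + z)
  x-y≡[x+z]-[y+z] = solve-∀

x+m≡x-mod : ∀ {m} x → x + + m ≡ x mod m
x+m≡x-mod {m} x = ≡mod (subst (_ ∣_) (sym (x+k-x≡k x (+ m))) ∣-refl)
  where
  x+k-x≡k : ∀ x k → x + k - x ≡ k
  x+k-x≡k = solve-∀

x-m≡x-mod : ∀ {m} x → x - + m ≡ x mod m
x-m≡x-mod {m} x = ≡mod-sym (subst (_≡ x - + m mod m) (x-k+k≡x x (+ m)) (x+m≡x-mod (x - + m)))

%ℕ≡0⇒∣ : ∀ z d .{{_ : ℕ.NonZero d}} → z %ℕ d ≡ 0 → + d ∣ z
%ℕ≡0⇒∣ z d r≡0 = divides (z /ℕ d) (begin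
  z                          ≡⟨ a≡a%ℕn+[a/ℕn]*n z d ⟩
  + (z %ℕ d) + z /ℕ d * + d  ≡⟨ cong (λ r → + r + z /ℕ d * + d) r≡0 ⟩
  0ℤ + z /ℕ d * + d          ≡⟨ ℤ.+-identityˡ _ ⟩
  z /ℕ d * + d               ∎)
  where open ≡-Reasoning

∣⇒%ℕ≡0 : ∀ z d .{{_ : ℕ.NonZero d}} → + d ∣ z → z %ℕ d ≡ 0
∣⇒%ℕ≡0 (+ k)    d d∣z = ℕ.n∣m⇒m%n≡0 k d (∣⇒∣ᵤ d∣z)
∣⇒%ℕ≡0 -[1+ k ] d d∣z rewrite ℕ.n∣m⇒m%n≡0 (suc k) d (∣⇒∣ᵤ d∣z) = refl

congMod-reflects : ∀ m x y → Reflects (x ≡ y mod m) (congMod m x y)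
congMod-reflects zero x y with x ℤ.≟ y
... | yes refl = ofʸ ≡mod-refl
... | no x≢y   = ofⁿ λ (≡mod (divides q x-y≡q*0)) →
  x≢y (ℤ.i-j≡0⇒i≡j x y (trans x-y≡q*0 (ℤ.*-zeroʳ q)))
congMod-reflects (suc k) x y with (x - y) %ℕ suc k ℕ.≟ 0
... | yes r≡0 = ofʸ (≡mod (%ℕ≡0⇒∣ (x - y) (suc k) r≡0))
... | no r≢0  = ofⁿ λ (≡mod m∣x-y) → r≢0 (∣⇒%ℕ≡0 (x - y) (suc k) m∣x-y)

x%ℕm≡x-mod : ∀ x m .{{_ : ℕ.NonZero m}} → + (x %ℕ m) ≡ x mod m
x%ℕm≡x-mod x m = ≡mod-sym (≡mod (divides (x /ℕ m) (begin
  x - + (x %ℕ m)                           ≡⟨ cong (_- + (x %ℕ m)) (a≡a%ℕn+[a/ℕn]*n x m) ⟩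
  + (x %ℕ m) + x /ℕ m * + m - + (x %ℕ m)   ≡⟨ r+s-r≡s (+ (x %ℕ m)) (x /ℕ m * + m) ⟩
  x /ℕ m * + m                             ∎)))
  where
  open ≡-Reasoning
  r+s-r≡s : ∀ r s → r + s - r ≡ s
  r+s-r≡s = solve-∀

≡mod-neg-neg : ∀ {m i j} → j ≡ - - i mod m → j ≡ i mod m
≡mod-neg-neg {m} {i} {j} = subst (λ k → j ≡ k mod m) (ℤ.neg-involutive i)

≡mod-neg-neg⁻¹ : ∀ {m i j} → j ≡ i mod m → j ≡ - - i mod m
≡mod-neg-neg⁻¹ {m} {i} {j} = subst (λ k → j ≡ k mod m) (sym (ℤ.neg-involutive i))

≡mod-offset : ∀ {m x y} → x ≡ y mod m → ∃[ k ] (x ≡ y + + k * + m ⊎ y ≡ x + + k * + m)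
≡mod-offset {m} {x} {y} (≡mod (divides (+ k) x-y≡)) = k , inj₁ (begin
  x                ≡⟨ x≡y+[x-y] x y ⟩
  y + (x - y)      ≡⟨ cong (λ d → y + d) x-y≡ ⟩
  y + + k * + m    ∎)
  where open ≡-Reasoning
≡mod-offset {m} {x} {y} (≡mod (divides -[1+ k ] x-y≡)) = suc k , inj₂ (begin
  y                       ≡⟨ x≡y+[x-y] y x ⟩
  x + (y - x)             ≡⟨ cong (λ d → x + d) (-[x-y]≡y-x x y) ⟨
  x + - (x - y)           ≡⟨ cong (λ d → x + - d) x-y≡ ⟩
  x + - (-[1+ k ] * + m)  ≡⟨ cong (λ d → x + d) (ℤ.neg-distribˡ-* -[1+ k ] (+ m)) ⟩
  x + +[1+ k ] * + m      ∎)
  where open ≡-Reasoning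

≡mod-apart : ∀ {m x y} → x ≡ y mod m → x ≢ y → x + + m ≤ y ⊎ y + + m ≤ x
≡mod-apart {m} {x} {y} x≡y x≢y with ≡mod-offset x≡y
... | zero  , inj₁ x≡y+0 = contradiction (trans x≡y+0 (ℤ.+-identityʳ y)) x≢y
... | zero  , inj₂ y≡x+0 = contradiction (sym (trans y≡x+0 (ℤ.+-identityʳ x))) x≢y
... | suc k , inj₁ x≡y+[1+k]m = inj₂ (begin
  y + + m               ≤⟨ ℤ.+-monoʳ-≤ y (m≤[1+k]*m k) ⟩
  y + + suc k * + m     ≡⟨ x≡y+[1+k]m ⟨
  x                     ∎)
  where open ℤ.≤-Reasoning
... | suc k , inj₂ y≡x+[1+k]m = inj₁ (begin
  x + + m               ≤⟨ ℤ.+-monoʳ-≤ x (m≤[1+k]*m k) ⟩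
  x + + suc k * + m     ≡⟨ y≡x+[1+k]m ⟨
  y                     ∎)
  where open ℤ.≤-Reasoning

both-false-⇔ : ∀ {A B : Set} → ¬ A → ¬ B → A ⇔ B
both-false-⇔ ¬a ¬b = mk⇔ (λ a → contradiction a ¬a) (λ b → contradiction b ¬b)

both-true-⇔ : ∀ {A B : Set} → A → B → A ⇔ B
both-true-⇔ a b = mk⇔ (const b) (const a)

ChangesOnlyAt : (ℤ → Set) → ℕ → ℤ → Set
ChangesOnlyAt Pos m c = ∀ {y} → y ≡ c mod m → y ≢ c → Pos (y - + m) ⇔ Pos y

<-changesOnlyAt : ∀ {t c m} → t ≤ c → c < t + + m → ChangesOnlyAt (_< t) m c
<-changesOnlyAt {t} {c} {m} t≤c c<t+m {y} y≡c y≢c with ≡mod-apart y≡c y≢c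
... | inj₁ y+m≤c = both-true-⇔ (ℤ.≤-<-trans (ℤ.i-j≤i y (+ m)) y<t) y<t
  where
  y<t : y < t
  y<t = +-cancelʳ-< (+ m) (ℤ.≤-<-trans y+m≤c c<t+m)
... | inj₂ c+m≤y = both-false-⇔ (ℤ.≤⇒≯ t≤y-m) (ℤ.≤⇒≯ (ℤ.≤-trans t≤y-m (ℤ.i-j≤i y (+ m))))
  where
  t≤y-m : t ≤ y - + m
  t≤y-m = +≤⇒≤- (+ m) (ℤ.≤-trans (ℤ.+-monoˡ-≤ (+ m) t≤c) c+m≤y)

>-changesOnlyAt : ∀ {t c m} → t < c → c ≤ t + + m → ChangesOnlyAt (t <_) m c
>-changesOnlyAt {t} {c} {m} t<c c≤t+m {y} y≡c y≢c with ≡mod-apart y≡c y≢c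
... | inj₁ y+m≤c = both-false-⇔ (ℤ.≤⇒≯ (ℤ.≤-trans (ℤ.i-j≤i y (+ m)) y≤t)) (ℤ.≤⇒≯ y≤t)
  where
  y≤t : y ≤ t
  y≤t = +-cancelʳ-≤ (+ m) (ℤ.≤-trans y+m≤c c≤t+m)
... | inj₂ c+m≤y = both-true-⇔ t<y-m (ℤ.<-≤-trans t<y-m (ℤ.i-j≤i y (+ m)))
  where
  t<y-m : t < y - + m
  t<y-m = +<⇒<- (+ m) (ℤ.<-≤-trans (ℤ.+-monoˡ-< (+ m) t<c) c+m≤y)

module _ (n : ℕ) where

  private
    2n = period n

  data LoopView (i j : ℤ) : ℤ → Set where
    up    : j ≡ i mod 2n → LoopView i j (j + + 2n)
    down  : ¬ j ≡ i mod 2n → j ≡ - i mod 2n → LoopView i j (j - + 2n)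
    fixed : ¬ j ≡ i mod 2n → ¬ j ≡ - i mod 2n → LoopView i j j

  loopView : ∀ i j → LoopView i j (loop n i j)
  loopView i j with congMod 2n j i | congMod-reflects 2n j i
  ... | true  | ofʸ j≡i = up j≡i
  ... | false | ofⁿ j≢i with congMod 2n j (- i) | congMod-reflects 2n j (- i)
  ...   | true  | ofʸ j≡-i  = down j≢i j≡-i
  ...   | false | ofⁿ j≢-i = fixed j≢i j≢-i

  loop-on-i : ∀ {i j} → j ≡ i mod 2n → loop n i j ≡ j + + 2n
  loop-on-i {i} {j} j≡i with loop n i j | loopView i j
  ... | _ | up _        = refl
  ... | _ | down j≢i _  = contradiction j≡i j≢i
  ... | _ | fixed j≢i _ = contradiction j≡i j≢i

  loop-on-neg-i : ∀ {i j} → ¬ i ≡ - i mod 2n → j ≡ - i mod 2n → loop n i j ≡ j - + 2n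
  loop-on-neg-i {i} {j} i≢-i j≡-i with loop n i j | loopView i j
  ... | _ | up j≡i        = contradiction (≡mod-trans (≡mod-sym j≡i) j≡-i) i≢-i
  ... | _ | down _ _      = refl
  ... | _ | fixed _ j≢-i  = contradiction j≡-i j≢-i

  loop-off : ∀ {i j} → ¬ j ≡ i mod 2n → ¬ j ≡ - i mod 2n → loop n i j ≡ j
  loop-off {i} {j} j≢i j≢-i with loop n i j | loopView i j
  ... | _ | up j≡i       = contradiction j≡i j≢i
  ... | _ | down _ j≡-i  = contradiction j≡-i j≢-i
  ... | _ | fixed _ _    = refl

  loop∘loop-neg≡id : ∀ {i} → ¬ i ≡ - i mod 2n → ∀ j → loop n i (loop n (- i) j) ≡ j
  loop∘loop-neg≡id {i} i≢-i j with loop n (- i) j | loopView (- i) j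
  ... | _ | up j≡-i =
    trans (loop-on-neg-i i≢-i (≡mod-trans (x+m≡x-mod j) j≡-i)) (x+k-k≡x j (+ 2n))
  ... | _ | down _ j≡--i =
    trans (loop-on-i (≡mod-trans (x-m≡x-mod j) (≡mod-neg-neg j≡--i))) (x-k+k≡x j (+ 2n))
  ... | _ | fixed j≢-i j≢--i =
    loop-off (j≢--i ∘ ≡mod-neg-neg⁻¹) j≢-i

  neg-preserves-≢-neg : ∀ {i} → ¬ i ≡ - i mod 2n → ¬ - i ≡ - - i mod 2n
  neg-preserves-≢-neg i≢-i -i≡--i = i≢-i (≡mod-sym (≡mod-neg-neg -i≡--i))

  loop-neg∘loop≡id : ∀ {i} → ¬ i ≡ - i mod 2n → ∀ j → loop n (- i) (loop n i j) ≡ j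
  loop-neg∘loop≡id {i} i≢-i j =
    subst (λ k → loop n (- i) (loop n k j) ≡ j) (ℤ.neg-involutive i)
      (loop∘loop-neg≡id (neg-preserves-≢-neg i≢-i) j)

  loop-neg-on-i : ∀ {i c} → ¬ i ≡ - i mod 2n → c ≡ i mod 2n → loop n (- i) c ≡ c - + 2n
  loop-neg-on-i {i} {c} i≢-i c≡i =
    loop-on-neg-i (neg-preserves-≢-neg i≢-i) (≡mod-neg-neg⁻¹ c≡i)

  loop-neg-preserves : ∀ {Pos : ℤ → Set} {i c d} → c ≡ i mod 2n → d ≡ - i mod 2n →
                     ChangesOnlyAt Pos 2n c → ChangesOnlyAt Pos 2n (d + + 2n) →
                     ∀ y → y ≢ c → y ≢ d → Pos (loop n (- i) y) ⇔ Pos y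
  loop-neg-preserves {Pos} {i} {c} {d} c≡i d≡-i changes-c changes-d+2n y y≢c y≢d
    with loop n (- i) y | loopView (- i) y
  ... | _ | up y≡-i =
    ⇔-sym (subst (λ z → Pos z ⇔ Pos (y + + 2n)) (x+k-k≡x y (+ 2n)) (changes-d+2n y+2n≡d+2n y+2n≢d+2n))
    where
    y+2n≡d+2n : y + + 2n ≡ d + + 2n mod 2n
    y+2n≡d+2n = ≡mod-+ʳ (+ 2n) (≡mod-trans y≡-i (≡mod-sym d≡-i))
    y+2n≢d+2n : y + + 2n ≢ d + + 2n
    y+2n≢d+2n = y≢d ∘ +-cancelʳ-≡ (+ 2n)
  ... | _ | down _ y≡--i = changes-c (≡mod-trans (≡mod-neg-neg y≡--i) (≡mod-sym c≡i)) y≢c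
  ... | _ | fixed _ _ = ⇔-id _

period≡n+n : ∀ n → + period n ≡ + n + + n
period≡n+n n = trans (cong (λ k → + (n ℕ.+ k)) (ℕ.+-identityʳ n)) (ℤ.pos-+ n n)

-n+2n≡n : ∀ n → - + n + + period n ≡ + n
-n+2n≡n n = trans (cong (λ k → - + n + k) (period≡n+n n)) (-y+[y+y]≡y (+ n))
  where
  -y+[y+y]≡y : ∀ y → - y + (y + y) ≡ y
  -y+[y+y]≡y = solve-∀

n<x+2n : ∀ {n x} → - + n < x → + n < x + + period n
n<x+2n {n} {x} -n<x = begin-strict
  + n                   ≡⟨ -n+2n≡n n ⟨
  - + n + + period n    <⟨ ℤ.+-monoˡ-< (+ period n) -n<x ⟩
  x + + period n        ∎
  where open ℤ.≤-Reasoning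

-n<x⇒-x<n : ∀ {n x} → - + n < x → - x < + n
-n<x⇒-x<n {n} -n<x = subst (_ <_) (ℤ.neg-involutive (+ n)) (ℤ.neg-mono-< -n<x)

n<v+2n⊻n<-v : ∀ {n v} → v ≢ - + n →
              (+ n < v + + period n × ¬ + n < - v) ⊎ (¬ + n < v + + period n × + n < - v)
n<v+2n⊻n<-v {n} {v} v≢-n with ℤ.<-cmp v (- + n)
... | tri< v<-n _ _ = inj₂ (ℤ.<-asym v+2n<n , subst (_< - v) (ℤ.neg-involutive (+ n)) (ℤ.neg-mono-< v<-n))
  where
  v+2n<n : v + + period n < + n
  v+2n<n = subst (v + + period n <_) (-n+2n≡n n) (ℤ.+-monoˡ-< (+ period n) v<-n)
... | tri≈ _ v≡-n _ = contradiction v≡-n v≢-n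
... | tri> _ _ -n<v = inj₁ (n<x+2n -n<v , ℤ.<-asym (-n<x⇒-x<n -n<v))

1≤∣i∣⇒i≢0 : ∀ {i} → 1 ℕ.≤ ∣ i ∣ → i ≢ 0ℤ
1≤∣i∣⇒i≢0 1≤∣i∣ i≡0 = ℕ.<⇒≢ 1≤∣i∣ (sym (cong ∣_∣ i≡0))

∣i∣<n⇒-n<i : ∀ {n i} → ∣ i ∣ ℕ.< n → - + n < i
∣i∣<n⇒-n<i {suc n} {+ _}      _           = ℤ.-<+
∣i∣<n⇒-n<i {suc n} { -[1+ _ ]} (s≤s k<n) = ℤ.-<- k<n

∣i∣<n⇒i<n : ∀ {n i} → ∣ i ∣ ℕ.< n → i < + n
∣i∣<n⇒i<n {i = + _}      k<n = ℤ.+<+ k<n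
∣i∣<n⇒i<n {i = -[1+ _ ]} _   = ℤ.-<+

module _ {n : ℕ} .{{_ : ℕ.NonZero n}} (π : AffSignedPerm n) where

  private
    2n = period n
    instance
      period≢0 : ℕ.NonZero 2n
      period≢0 = ℕ.m*n≢0 2 n

  fn-injective : ∀ {x y} → fn π x ≡ fn π y → x ≡ y
  fn-injective = proj₁ (bijective π)

  fn-0 : fn π 0ℤ ≡ 0ℤ
  fn-0 = i≡-i⇒i≡0 (signed π 0ℤ)

  fn-n : fn π (+ n) ≡ + n
  fn-n = x≡-x+[y+y]⇒x≡y (begin
    fn π (+ n)                    ≡⟨ cong (fn π) (-n+2n≡n n) ⟨
    fn π (- + n + + 2n)            ≡⟨ periodic π (- + n) ⟩
    fn π (- + n) + + 2n            ≡⟨ cong (_+ + 2n) (signed π (+ n)) ⟩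
    - fn π (+ n) + + 2n            ≡⟨ cong (λ k → - fn π (+ n) + k) (period≡n+n n) ⟩
    - fn π (+ n) + (+ n + + n)    ∎)
    where open ≡-Reasoning

  displacement : ℤ → ℤ
  displacement x = fn π x - x

  displacement-+2n : ∀ x → displacement (x + + 2n) ≡ displacement x
  displacement-+2n x = begin
    fn π (x + + 2n) - (x + + 2n)   ≡⟨ cong (_- (x + + 2n)) (periodic π x) ⟩
    fn π x + + 2n - (x + + 2n)     ≡⟨ [y+k]-[x+k]≡y-x (fn π x) x (+ 2n) ⟩
    fn π x - x                   ∎
    where
    open ≡-Reasoning
    [y+k]-[x+k]≡y-x : ∀ y x k → (y + k) - (x + k) ≡ y - x
    [y+k]-[x+k]≡y-x = solve-∀

  displacement-+k*2n : ∀ x k → displacement (x + + k * + 2n) ≡ displacement x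
  displacement-+k*2n x zero    = cong displacement (ℤ.+-identityʳ x)
  displacement-+k*2n x (suc k) = begin
    displacement (x + + suc k * + 2n)     ≡⟨ cong displacement (x+[1+k]*m≡x+k*m+m x (+ k) (+ 2n)) ⟩
    displacement (x + + k * + 2n + + 2n)   ≡⟨ displacement-+2n (x + + k * + 2n) ⟩
    displacement (x + + k * + 2n)         ≡⟨ displacement-+k*2n x k ⟩
    displacement x                       ∎
    where
    open ≡-Reasoning
    x+[1+k]*m≡x+k*m+m : ∀ x k m → x + (+ 1 + k) * m ≡ x + k * m + m
    x+[1+k]*m≡x+k*m+m = solve-∀

  displacement-≡mod : ∀ {x y} → x ≡ y mod 2n → displacement x ≡ displacement y
  displacement-≡mod {x} {y} x≡y with ≡mod-offset x≡y
  ... | k , inj₁ x≡y+km = trans (cong displacement x≡y+km) (displacement-+k*2n y k)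
  ... | k , inj₂ y≡x+km = sym (trans (cong displacement y≡x+km) (displacement-+k*2n x k))

  maxDisplacement : ℕ
  maxDisplacement = max 0 (map (λ r → ∣ displacement (+ r) ∣) (upTo 2n))

  ∣displacement∣≤max : ∀ x → ∣ displacement x ∣ ℕ.≤ maxDisplacement
  ∣displacement∣≤max x =
    subst (ℕ._≤ maxDisplacement) (cong ∣_∣ (displacement-≡mod (x%ℕm≡x-mod x 2n)))
      (All.lookup (xs≤max 0 _) (∈-map⁺ (λ r → ∣ displacement (+ r) ∣) (∈-upTo⁺ (n%ℕd<d x 2n))))

  fn≤x+max : ∀ x → fn π x ≤ x + + maxDisplacement
  fn≤x+max x = begin
    fn π x                         ≡⟨ x≡y+[x-y] (fn π x) x ⟩
    x + displacement x             ≤⟨ ℤ.+-monoʳ-≤ x (i≤+∣i∣ (displacement x)) ⟩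
    x + + ∣ displacement x ∣       ≤⟨ ℤ.+-monoʳ-≤ x (ℤ.+≤+ (∣displacement∣≤max x)) ⟩
    x + + maxDisplacement          ∎
    where open ℤ.≤-Reasoning

  x-max≤fn : ∀ x → x - + maxDisplacement ≤ fn π x
  x-max≤fn x = begin
    x - + maxDisplacement          ≤⟨ ℤ.+-monoʳ-≤ x (ℤ.neg-mono-≤ (ℤ.+≤+ (∣displacement∣≤max x))) ⟩
    x - + ∣ displacement x ∣       ≤⟨ ℤ.+-monoʳ-≤ x (-+∣i∣≤i (displacement x)) ⟩
    x + displacement x             ≡⟨ x≡y+[x-y] (fn π x) x ⟨
    fn π x                         ∎
    where open ℤ.≤-Reasoning

  numBig-exists : ∃ (NumBig n (fn π))
  numBig-exists = bounded⇒HasCard (λ x → (x ℤ.<? + n) ×-dec (+ n ℤ.<? fn π x)) bounds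
    where
    bounds : ∀ x → BigSet n (fn π) x → + n - + maxDisplacement ≤ x × x < + n
    bounds x (x<n , n<fx) = ≤+⇒-≤ _ (ℤ.<⇒≤ (ℤ.<-≤-trans n<fx (fn≤x+max x))) , x<n

  numNeg-exists : ∃ (NumNeg (fn π))
  numNeg-exists = bounded⇒HasCard (λ x → (0ℤ ℤ.<? x) ×-dec (fn π x ℤ.<? 0ℤ)) bounds
    where
    bounds : ∀ x → NegSet (fn π) x → 0ℤ ≤ x × x < + maxDisplacement
    bounds x (0<x , fx<0) = ℤ.<⇒≤ 0<x , -<⇒<+ _ (ℤ.≤-<-trans (x-max≤fn x) fx<0)

  module _ {i : ℤ} (1≤∣i∣ : 1 ℕ.≤ ∣ i ∣) (∣i∣<n : ∣ i ∣ ℕ.< n) where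

    private
      -n<i : - + n < i
      -n<i = ∣i∣<n⇒-n<i {i = i} ∣i∣<n
      i<n : i < + n
      i<n = ∣i∣<n⇒i<n {i = i} ∣i∣<n

    i≢-i : ¬ i ≡ - i mod 2n
    i≢-i i≡-i with ≡mod-apart i≡-i (1≤∣i∣⇒i≢0 {i} 1≤∣i∣ ∘ i≡-i⇒i≡0)
    ... | inj₁ i+2n≤-i =
      ℤ.<-irrefl refl (ℤ.<-trans (ℤ.<-≤-trans (n<x+2n -n<i) i+2n≤-i) (-n<x⇒-x<n -n<i))
    ... | inj₂ -i+2n≤i =
      ℤ.<-irrefl refl (ℤ.<-trans (ℤ.<-≤-trans (n<x+2n (ℤ.neg-mono-< i<n)) -i+2n≤i) i<n)

    numBig-loop : ∃[ a ] ∃[ b ] NumBig n (fn π) a × NumBig n (mulLoop π i) b × OffByOne a b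
    numBig-loop =
      let a , big = numBig-exists
          b , big′ , a~b = HasCard-relabel {Pos = _< + n} {Val = (+ n <_) ∘ fn π}
                             (loop-neg∘loop≡id n i≢-i) (loop∘loop-neg≡id n i≢-i) (i + + 2n) (- i)
                             (ℤ.≤⇒≯ (ℤ.<⇒≤ (n<x+2n -n<i))) loop-neg[i+2n]<n
                             (-n<x⇒-x<n -n<i) loop-neg[-i]≮n off xor big
      in  a , b , big , big′ , a~b
      where
      loop-neg[i+2n]<n : loop n (- i) (i + + 2n) < + n
      loop-neg[i+2n]<n =
        subst (_< + n) (sym (trans (loop-neg-on-i n i≢-i (x+m≡x-mod i)) (x+k-k≡x i (+ 2n)))) i<n
      loop-neg[-i]≮n : ¬ loop n (- i) (- i) < + n
      loop-neg[-i]≮n rewrite loop-on-i n (≡mod-refl {x = - i}) = ℤ.<-asym (n<x+2n (ℤ.neg-mono-< i<n))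
      off : ∀ y → y ≢ i + + 2n → y ≢ - i → loop n (- i) y < + n ⇔ y < + n
      off = loop-neg-preserves n (x+m≡x-mod i) ≡mod-refl
              (<-changesOnlyAt (ℤ.<⇒≤ (n<x+2n -n<i)) (ℤ.+-monoˡ-< (+ 2n) i<n))
              (<-changesOnlyAt (ℤ.<⇒≤ (n<x+2n (ℤ.neg-mono-< i<n))) (ℤ.+-monoˡ-< (+ 2n) (-n<x⇒-x<n -n<i)))
      fi≢-n : fn π i ≢ - + n
      fi≢-n fi≡-n = ℤ.<-irrefl (sym (fn-injective (begin
        fn π i          ≡⟨ fi≡-n ⟩
        - + n           ≡⟨ cong -_ fn-n ⟨
        - fn π (+ n)    ≡⟨ signed π (+ n) ⟨
        fn π (- + n)    ∎))) -n<i
        where open ≡-Reasoning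
      xor : (+ n < fn π (i + + 2n) × ¬ + n < fn π (- i)) ⊎ (¬ + n < fn π (i + + 2n) × + n < fn π (- i))
      xor rewrite periodic π i | signed π i = n<v+2n⊻n<-v fi≢-n

    private
      b : ℤ
      b = + (i %ℕ 2n)
      b≡i : b ≡ i mod 2n
      b≡i = x%ℕm≡x-mod i 2n
      i%2n≢0 : i %ℕ 2n ≢ 0
      i%2n≢0 r≡0 = i≢-i (≡mod-trans (≡mod-sym 0≡i) (≡mod-neg 0≡i))
        where
        0≡i : 0ℤ ≡ i mod 2n
        0≡i = subst (_≡ i mod 2n) (cong +_ r≡0) b≡i
      0<b : 0ℤ < b
      0<b = ℤ.+<+ (ℕ.n≢0⇒n>0 i%2n≢0)
      b<2n : b < + 2n
      b<2n = ℤ.+<+ (n%ℕd<d i 2n)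

    numNeg-loop : ∃[ c ] ∃[ d ] NumNeg (fn π) c × NumNeg (mulLoop π i) d × OffByOne c d
    numNeg-loop =
      let c , neg = numNeg-exists
          d , neg′ , c~d = HasCard-relabel {Pos = 0ℤ <_} {Val = (_< 0ℤ) ∘ fn π}
                             (loop-neg∘loop≡id n i≢-i) (loop∘loop-neg≡id n i≢-i) (- b) b
                             (ℤ.<-asym -b<0) 0<loop-neg[-b] 0<b 0≮loop-neg[b]
                             (λ y y≢-b y≢b → off y y≢b y≢-b) xor neg
      in  c , d , neg , neg′ , c~d
      where
      -b<0 : - b < 0ℤ
      -b<0 = ℤ.neg-mono-< 0<b
      0<-b+2n : 0ℤ < - b + + 2n
      0<-b+2n = subst (_< - b + + 2n) (ℤ.+-inverseˡ (+ 2n)) (ℤ.+-monoˡ-< (+ 2n) (ℤ.neg-mono-< b<2n))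
      0<loop-neg[-b] : 0ℤ < loop n (- i) (- b)
      0<loop-neg[-b] = subst (0ℤ <_) (sym (loop-on-i n (≡mod-neg b≡i))) 0<-b+2n
      0≮loop-neg[b] : ¬ 0ℤ < loop n (- i) b
      0≮loop-neg[b] rewrite loop-neg-on-i n i≢-i b≡i =
        ℤ.<-asym (subst (b - + 2n <_) (ℤ.+-inverseʳ (+ 2n)) (ℤ.+-monoˡ-< (- + 2n) b<2n))
      off : ∀ y → y ≢ b → y ≢ - b → 0ℤ < loop n (- i) y ⇔ 0ℤ < y
      off = loop-neg-preserves n b≡i (≡mod-neg b≡i)
              (>-changesOnlyAt 0<b (ℤ.<⇒≤ b<2n))
              (>-changesOnlyAt 0<-b+2n (ℤ.+-monoˡ-≤ (+ 2n) (ℤ.<⇒≤ -b<0)))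
      fb≢0 : fn π b ≢ 0ℤ
      fb≢0 fb≡0 = ℤ.<-irrefl (sym (fn-injective (trans fb≡0 (sym fn-0)))) 0<b
      xor : (fn π (- b) < 0ℤ × ¬ fn π b < 0ℤ) ⊎ (¬ fn π (- b) < 0ℤ × fn π b < 0ℤ)
      xor rewrite signed π b = -v<0⊻v<0 fb≢0

mainTheorem6 : (n : ℕ) → 3 ℕ.≤ n → (π : AffSignedPerm n) → (i : ℤ) → 1 ℕ.≤ ∣ i ∣ → ∣ i ∣ ℕ.< n →
    (Σ ℕ λ a → Σ ℕ λ b → NumBig n (fn π) a × NumBig n (mulLoop π i) b × (b ≡ suc a ⊎ a ≡ suc b))
    × (Σ ℕ λ c → Σ ℕ λ d → NumNeg (fn π) c × NumNeg (mulLoop π i) d × (d ≡ suc c ⊎ c ≡ suc d))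
mainTheorem6 zero    _ _ _ _ ()
mainTheorem6 (suc n) _ π i 1≤∣i∣ ∣i∣<n = numBig-loop π 1≤∣i∣ ∣i∣<n , numNeg-loop π 1≤∣i∣ ∣i∣<n
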